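{- Let $\mathcal{S}$ be a relational schema and $\mathcal{D}$ a domain of atomic values (identified with its algebraic representation, types being sorts and predicates Boolean-valued operators). Assume that for every relational algebra expression $R$ over $\mathcal{S}$ (built from base relations by projection, selection, union, Cartesian product and set difference) the signature contains a fact constructor $\mathcal{R}_R:s_1\ldots s_n\to\mathsf{Fact}$, where $n$ is the arity of $R$ and $s_i$ the sort of its $i$-th column. For a (finite) relational database $I$ with schema $\mathcal{S}$, let $\mathrm{Trb}(I)$ be the multiset $\circ\{\mathcal{R}_r(\vec t)\mid r\text{ a relation symbol of }\mathcal{S},\ \vec t\in r^I\}$. Then for every relational algebra expression $R$ there exists a closed, deterministic query $\mathrm{Tr}(R)$ such that for every relational database $I$ with schema $\mathcal{S}$ and every tuple $\vec t$: $\exists F.\ \mathrm{Init}_{\mathrm{Tr}(R)}(\mathrm{Trb}(I))\to^!\mathsf{Ans}(F\circ\mathcal{R}_R(\vec t))$ iff $\vec t\in\mathrm{Eval}_I(R)$, where $\mathrm{Eval}_I(R)$ is the set of tuples obtained by evaluating $R$ on $I$.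
   Context: Setting. $\Sigma$ is an order-sorted algebraic signature with sorts $\mathsf{Fact}$ and $\mathsf{Bool}$, $\mathcal{D}$ a $\Sigma$-algebra of facts presented by equational attributes $A$ (associativity, commutativity, identity) and directed equations confluent and terminating modulo $A$, defining Boolean connectives and Boolean equality on every sort; every ground $\mathsf{Bool}$ term reduces to $\mathit{true}$ or $\mathit{false}$. Terms are fully reduced, compared modulo $A$. Finite multisets of facts use an associative-commutative union $\circ$ with identity $\emptyset$. Patterns: AC $\circ$-combinations of blocks $[F]_!$, $[F]_?$ ($F$ non-empty multiset of possibly non-ground facts), with $[F_1]_m\circ[F_2]_m=[F_1\circ F_2]_m$; $P_!,P_?$ are the multisets of facts in the respective blocks. Terminating-and-preserving: only $!$- and $?$-blocks and $P_?\ne\emptyset$. Conditions: $\mathsf{False}$; $\{B\}$ ($B$ a $\mathsf{Bool}$ term); $\neg\psi$; $\psi_1\vee\psi_2$; $\exists P.\psi$ ($P$ terminating-and-preserving), the quantifier binding in $\psi$ the variables of $P$ not bound by the context. Condition rewriting on stacks $T$ of frames $\mathsf{Res}(B)$, $\mathsf{Not}$, $[\vec a]^{\vec v}_\psi$, $[\vec a]^{\vec v,\downarrow}_\psi$, $[G\mid\vec a]^{\vec v}_{\exists P.\psi}$ ($\sigma=\{\vec a/\vec v\}$) over a database $F$, where "$X\mapsto Y$" replaces the top segment $X$ by $Y$: (1) $[\vec a]^{\vec v}_{\mathsf{False}}\mapsto\mathsf{Res}(\mathit{false})$, $[\vec a]^{\vec v}_{\{B\}}\mapsto\mathsf{Res}(\sigma(B))$;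 (2) $[\vec a]^{\vec v}_{\neg\psi}\mapsto\mathsf{Not}[\vec a]^{\vec v}_\psi$, $\mathsf{Not}\,\mathsf{Res}(B)\mapsto\mathsf{Res}(\neg B)$; (3) $[\vec a]^{\vec v}_{\psi_1\vee\psi_2}\mapsto[\vec a]^{\vec v,\downarrow}_{\psi_1}[\vec a]^{\vec v}_{\psi_2}$, $[\vec a]^{\vec v,\downarrow}_\psi\mathsf{Res}(\mathit{true})\mapsto\mathsf{Res}(\mathit{true})$, $[\vec a]^{\vec v,\downarrow}_\psi\mathsf{Res}(\mathit{false})\mapsto[\vec a]^{\vec v}_\psi$; (4) $[\vec a]^{\vec v}_{\exists P.\psi}\mapsto[F\mid\vec a]^{\vec v}_{\exists P.\psi}$; (5) with $\vec w$ the variables of $P$ not in $\vec v$, if $G=G'\circ\sigma'(P_!\circ P_?)$ for $\sigma'=\{\vec a/\vec v,\vec b/\vec w\}$, then $[G\mid\vec a]_{\exists P.\psi}\mapsto[G'\circ\sigma'(P_!)\mid\vec a]_{\exists P.\psi}[\vec a,\vec b]^{\vec v,\vec w}_\psi$; (6) $[G\mid\vec a]_{\exists P.\psi}\mathsf{Res}(\mathit{false})\mapsto[G\mid\vec a]_{\exists P.\psi}$, $[G\mid\vec a]_{\exists P.\psi}\mathsf{Res}(\mathit{true})\mapsto\mathsf{Res}(\mathit{true})$; (7) if no decomposition as in (5) exists, $[G\mid\vec a]_{\exists P.\psi}\mapsto\mathsf{Res}(\mathit{false})$. Queries: $\emptyset$; any fact $f$ (possibly with variables); $Q_1\oplus Q_2$;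 $\varphi\Rightarrow Q$ ($\varphi$ a condition); $\mathsf{From}\,P.\,Q$ with $P$ terminating-and-preserving, binding in $Q$ the variables of $P$ not bound by the context. A query is closed iff all its variables are bound. Query system $\mathcal{R}^{\mathrm{query}}(Q)$: states $\{F,F',S\}^q$ ($F$ database, $F'$ partial answer, $S$ stack, top at right) or $\mathsf{Ans}(F')$. Frames $[\vec a]^{\vec v}_R$, $[\vec a\mid T]^{\vec v}_R$ ($T$ condition stack), $[G\mid\vec a]^{\vec v}_{\mathsf{From}\,P.R}$. Rules: $[\vec a]_f$ at top is popped and $\sigma(f)$ added to $F'$; $[\vec a]_\emptyset$ is popped; $[\vec a]_{R_1\oplus R_2}\mapsto[\vec a]_{R_2}[\vec a]_{R_1}$; $[\vec a]^{\vec v}_{\varphi\Rightarrow R}\mapsto[\vec a\mid[\vec a]^{\vec v}_\varphi]_R$; $[\vec a\mid T]_R\mapsto[\vec a\mid T']_R$ when $T$ rewrites to $T'$ by a condition rule over $F$; $[\vec a\mid\mathsf{Res}(\mathit{false})]_R$ is popped; $[\vec a\mid\mathsf{Res}(\mathit{true})]_R\mapsto[\vec a]_R$; $[\vec a]_{\mathsf{From}\,P.R}\mapsto[F\mid\vec a]_{\mathsf{From}\,P.R}$; if $G=G'\circ\sigma'(P_!\circ P_?)$, $\sigma'=\{\vec a/\vec v,\vec b/\vec w\}$, then $[G\mid\vec a]_{\mathsf{From}\,P.R}\mapsto[G'\circ\sigma'(P_!)\mid\vec a]_{\mathsf{From}\,P.R}[\vec a,\vec b]^{\vec v,\vec w}_R$;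 if no such decomposition exists, $[G\mid\vec a]_{\mathsf{From}\,P.R}$ is popped; $\{F,F',\text{empty}\}^q\to\mathsf{Ans}(F')$. $\mathrm{Init}_Q(F)=\{F,\emptyset,[\,]_Q\}^q$. $t\to^!u$ means $t\to^*u$ with $u$ irreducible. A fully reduced fact term $t$ has the unique matching property iff for every ground fully reduced fact $t'$ there is at most one substitution $\sigma$ with $\sigma(t)=_At'$. A query is deterministic iff every quantification pattern in it (including inside conditions) consists of a single fact with the unique matching property. -}

module Defs where

open import Data.Bool using (Bool; true; false; not; _∧_; _∨_)
open import Data.Nat using (ℕ)
open import Data.Fin using (Fin)
open import Data.List using (List; []; _∷_; _++_; map; concat; allFin)
open import Data.List.NonEmpty using (List⁺) renaming (toList to toList⁺)
open import Data.List.Relation.Unary.All using (All; []; _∷_) renaming (map to mapAll; lookup to lookupAll)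
open import Data.List.Relation.Unary.All.Properties using (++⁺)
open import Data.List.Relation.Unary.Any using (Any; index)
open import Data.List.Relation.Unary.Unique.Propositional using (Unique)
open import Data.List.Membership.Propositional using (_∈_)
open import Data.List.Membership.Propositional.Properties using (∈-++⁺ʳ)
open import Data.List.Relation.Binary.Permutation.Propositional using (_↭_)
open import Data.Product using (Σ; ∃; _×_; _,_)
open import Data.Sum using (_⊎_)
open import Data.Empty using (⊥)
open import Data.Unit using (⊤)
open import Relation.Nullary using (¬_; does)
open import Relation.Binary.PropositionalEquality using (_≡_)
open import Relation.Binary.Definitions using (DecidableEquality)
open import Relation.Binary.Construct.Closure.ReflexiveTransitive using (Star)

-- The domain D of atomic values, in its algebraic representation:
-- sorts, values (fully reduced ground terms) of each sort, Boolean
-- equality on every sort, and Boolean-valued operators (predicates).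

record Domain : Set₁ where
  field
    Sort  : Set
    Val   : Sort → Set
    _≟v_  : ∀ {s} → DecidableEquality (Val s)
    Pred  : List Sort → Set
    ⟦_⟧P  : ∀ {ts} → Pred ts → All Val ts → Bool

record Schema (D : Domain) : Set where
  open Domain D
  field
    nRel  : ℕ
    arity : Fin nRel → List Sort

module Lang (D : Domain) (Sch : Schema D) where
  open Domain D
  open Schema Sch

  Ctx : Set
  Ctx = List Sort

  Tuple : List Sort → Set
  Tuple ss = All Val ss

  Env : Ctx → Set
  Env Γ = All Val Γ

  data Term (Γ : Ctx) (s : Sort) : Set where
    var : s ∈ Γ → Term Γ s
    val : Val s → Term Γ s

  data BTerm (Γ : Ctx) : Set where
    tt ff : BTerm Γ
    ¬b    : BTerm Γ → BTerm Γ
    _∧b_  : BTerm Γ → BTerm Γ → BTerm Γ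
    _∨b_  : BTerm Γ → BTerm Γ → BTerm Γ
    _==_  : ∀ {s} → Term Γ s → Term Γ s → BTerm Γ
    pred  : ∀ {ts} → Pred ts → All (Term Γ) ts → BTerm Γ

  evalT : ∀ {Γ s} → Env Γ → Term Γ s → Val s
  evalT ρ (var x) = lookupAll ρ x
  evalT ρ (val v) = v

  evalB : ∀ {Γ} → Env Γ → BTerm Γ → Bool
  evalB ρ tt = true
  evalB ρ ff = false
  evalB ρ (¬b b) = not (evalB ρ b)
  evalB ρ (b ∧b c) = evalB ρ b ∧ evalB ρ c
  evalB ρ (b ∨b c) = evalB ρ b ∨ evalB ρ c
  evalB ρ (t == u) = does (evalT ρ t ≟v evalT ρ u)
  evalB ρ (pred p ts) = ⟦ p ⟧P (mapAll (evalT ρ) ts)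

  data RA : List Sort → Set where
    base  : (r : Fin nRel) → RA (arity r)
    proj  : ∀ {ss ts} → All (_∈ ss) ts → RA ss → RA ts
    sel   : ∀ {ss} → BTerm ss → RA ss → RA ss
    union : ∀ {ss} → RA ss → RA ss → RA ss
    prod  : ∀ {ss ts} → RA ss → RA ts → RA (ss ++ ts)
    diff  : ∀ {ss} → RA ss → RA ss → RA ss

  -- a finite relational database: for each relation symbol a finite set
  -- (duplicate-free list) of tuples
  Instance : Set
  Instance = (r : Fin nRel) → List (Tuple (arity r))

  ValidInstance : Instance → Set
  ValidInstance I = (r : Fin nRel) → Unique (I r)

  project : ∀ {ss ts} → All (_∈ ss) ts → Tuple ss → Tuple ts
  project cs u = mapAll (lookupAll u) cs

  Eval : Instance → ∀ {ss} → RA ss → Tuple ss → Set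
  Eval I (base r) t = t ∈ I r
  Eval I (proj cs R) t = ∃ λ u → Eval I R u × t ≡ project cs u
  Eval I (sel θ R) t = Eval I R t × evalB t θ ≡ true
  Eval I (union R S) t = Eval I R t ⊎ Eval I S t
  Eval I (prod R S) t = ∃ λ u → ∃ λ v → Eval I R u × Eval I S v × t ≡ ++⁺ u v
  Eval I (diff R S) t = Eval I R t × ¬ Eval I S t

  -- Facts: a constructor 𝓡_R : s₁…sₙ → Fact for every RA expression R.
  data GFact : Set where
    _⦅_⦆ : ∀ {ss} → RA ss → Tuple ss → GFact

  data FactT (Γ : Ctx) : Set where
    _⦅_⦆ : ∀ {ss} → RA ss → All (Term Γ) ss → FactT Γ

  -- databases / multisets of ground facts (lists taken up to permutation)
  DB : Set
  DB = List GFact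

  instF : ∀ {Γ} → Env Γ → FactT Γ → GFact
  instF ρ (R ⦅ ts ⦆) = R ⦅ mapAll (evalT ρ) ts ⦆

  Trb : Instance → DB
  Trb I = concat (map (λ r → map (λ t → base r ⦅ t ⦆) (I r)) (allFin nRel))

  OccT : ∀ {Γ s s'} → s ∈ Γ → Term Γ s' → Set
  OccT x (var y) = index x ≡ index y
  OccT x (val _) = ⊥

  OccArgs : ∀ {Γ s ss} → s ∈ Γ → All (Term Γ) ss → Set
  OccArgs x [] = ⊥
  OccArgs x (t ∷ ts) = OccT x t ⊎ OccArgs x ts

  OccF : ∀ {Γ s} → s ∈ Γ → FactT Γ → Set
  OccF x (R ⦅ ts ⦆) = OccArgs x ts

  record Pattern (Γ Δ : Ctx) : Set where
    field
      bang : List (FactT (Γ ++ Δ))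
      ques : List⁺ (FactT (Γ ++ Δ))
  open Pattern public

  allFacts : ∀ {Γ Δ} → Pattern Γ Δ → List (FactT (Γ ++ Δ))
  allFacts P = bang P ++ toList⁺ (ques P)

  data Cond (Γ : Ctx) : Set where
    False : Cond Γ
    ⟨_⟩   : BTerm Γ → Cond Γ
    ¬c    : Cond Γ → Cond Γ
    _∨c_  : Cond Γ → Cond Γ → Cond Γ
    ∃c    : (Δ : Ctx) → Pattern Γ Δ → Cond (Γ ++ Δ) → Cond Γ

  data Query (Γ : Ctx) : Set where
    ∅q    : Query Γ
    fact  : FactT Γ → Query Γ
    _⊕_   : Query Γ → Query Γ → Query Γ
    _⇒_   : Cond Γ → Query Γ → Query Γ
    From  : (Δ : Ctx) → Pattern Γ Δ → Query (Γ ++ Δ) → Query Γ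

  -- every newly bound variable actually occurs in the pattern
  -- (the quantifier binds exactly the variables of P not bound by the context)
  BindsAll : ∀ {Γ Δ} → Pattern Γ Δ → Set
  BindsAll {Γ} {Δ} P = ∀ {s} (x : s ∈ Δ) → Any (OccF (∈-++⁺ʳ Γ x)) (allFacts P)

  WFC : ∀ {Γ} → Cond Γ → Set
  WFC False = ⊤
  WFC ⟨ _ ⟩ = ⊤
  WFC (¬c ψ) = WFC ψ
  WFC (ψ ∨c φ) = WFC ψ × WFC φ
  WFC (∃c Δ P ψ) = BindsAll P × WFC ψ

  WFQ : ∀ {Γ} → Query Γ → Set
  WFQ ∅q = ⊤
  WFQ (fact _) = ⊤
  WFQ (Q ⊕ R) = WFQ Q × WFQ R
  WFQ (φ ⇒ Q) = WFC φ × WFQ Q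
  WFQ (From Δ P Q) = BindsAll P × WFQ Q

  Closed : Query [] → Set
  Closed Q = WFQ Q

  UMP : ∀ {Γ} → FactT Γ → Set
  UMP {Γ} f = (ρ ρ' : Env Γ) → instF ρ f ≡ instF ρ' f →
              ∀ {s} (x : s ∈ Γ) → OccF x f → lookupAll ρ x ≡ lookupAll ρ' x

  DetPat : ∀ {Γ Δ} → Pattern Γ Δ → Set
  DetPat P = Σ _ λ f → allFacts P ≡ f ∷ [] × UMP f

  DetC : ∀ {Γ} → Cond Γ → Set
  DetC False = ⊤
  DetC ⟨ _ ⟩ = ⊤
  DetC (¬c ψ) = DetC ψ
  DetC (ψ ∨c φ) = DetC ψ × DetC φ
  DetC (∃c Δ P ψ) = DetPat P × DetC ψ

  Deterministic : ∀ {Γ} → Query Γ → Set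
  Deterministic ∅q = ⊤
  Deterministic (fact _) = ⊤
  Deterministic (Q ⊕ R) = Deterministic Q × Deterministic R
  Deterministic (φ ⇒ Q) = DetC φ × Deterministic Q
  Deterministic (From Δ P Q) = DetPat P × Deterministic Q

  Match : ∀ {Γ Δ} → DB → Env Γ → Pattern Γ Δ → Env Δ → DB → Set
  Match G ρ P b G'' = ∃ λ G' →
      G ↭ (G' ++ map (instF (++⁺ ρ b)) (allFacts P))
    × G'' ≡ G' ++ map (instF (++⁺ ρ b)) (bang P)

  NoMatch : ∀ {Γ Δ} → DB → Env Γ → Pattern Γ Δ → Set
  NoMatch {Δ = Δ} G ρ P = ¬ (Σ (Env Δ) λ b → ∃ λ G'' → Match G ρ P b G'')

  -- Condition stacks (head of the list = top of the stack)
  data CFrame : Set where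
    Res   : Bool → CFrame
    Not   : CFrame
    ev    : ∀ {Γ} → Env Γ → Cond Γ → CFrame
    ev↓   : ∀ {Γ} → Env Γ → Cond Γ → CFrame
    exf   : ∀ {Γ Δ} → DB → Env Γ → Pattern Γ Δ → Cond (Γ ++ Δ) → CFrame
  CStack : Set
  CStack = List CFrame

  infix 4 _⊢_⟶c_
  data _⊢_⟶c_ (F : DB) : CStack → CStack → Set where
    r-false : ∀ {Γ} {ρ : Env Γ} {T} → F ⊢ ev ρ False ∷ T ⟶c Res false ∷ T
    r-atom  : ∀ {Γ} {ρ : Env Γ} {B T} → F ⊢ ev ρ ⟨ B ⟩ ∷ T ⟶c Res (evalB ρ B) ∷ T
    r-neg   : ∀ {Γ} {ρ : Env Γ} {ψ T} → F ⊢ ev ρ (¬c ψ) ∷ T ⟶c ev ρ ψ ∷ Not ∷ T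
    r-not   : ∀ {b T} → F ⊢ Res b ∷ Not ∷ T ⟶c Res (not b) ∷ T
    r-or    : ∀ {Γ} {ρ : Env Γ} {ψ₁ ψ₂ T} →
              F ⊢ ev ρ (ψ₁ ∨c ψ₂) ∷ T ⟶c ev ρ ψ₂ ∷ ev↓ ρ ψ₁ ∷ T
    r-or-t  : ∀ {Γ} {ρ : Env Γ} {ψ T} → F ⊢ Res true ∷ ev↓ ρ ψ ∷ T ⟶c Res true ∷ T
    r-or-f  : ∀ {Γ} {ρ : Env Γ} {ψ T} → F ⊢ Res false ∷ ev↓ ρ ψ ∷ T ⟶c ev ρ ψ ∷ T
    r-ex    : ∀ {Γ Δ} {ρ : Env Γ} {P : Pattern Γ Δ} {ψ T} →
              F ⊢ ev ρ (∃c Δ P ψ) ∷ T ⟶c exf F ρ P ψ ∷ T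
    r-ex-m  : ∀ {Γ Δ} {ρ : Env Γ} {P : Pattern Γ Δ} {ψ G G'' T} (b : Env Δ) →
              Match G ρ P b G'' →
              F ⊢ exf G ρ P ψ ∷ T ⟶c ev (++⁺ ρ b) ψ ∷ exf G'' ρ P ψ ∷ T
    r-ex-f  : ∀ {Γ Δ} {ρ : Env Γ} {P : Pattern Γ Δ} {ψ G T} →
              F ⊢ Res false ∷ exf G ρ P ψ ∷ T ⟶c exf G ρ P ψ ∷ T
    r-ex-t  : ∀ {Γ Δ} {ρ : Env Γ} {P : Pattern Γ Δ} {ψ G T} →
              F ⊢ Res true ∷ exf G ρ P ψ ∷ T ⟶c Res true ∷ T
    r-ex-n  : ∀ {Γ Δ} {ρ : Env Γ} {P : Pattern Γ Δ} {ψ G T} →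
              NoMatch G ρ P →
              F ⊢ exf G ρ P ψ ∷ T ⟶c Res false ∷ T

  data QFrame : Set where
    qev   : ∀ {Γ} → Env Γ → Query Γ → QFrame
    qcond : ∀ {Γ} → Env Γ → CStack → Query Γ → QFrame
    qfrom : ∀ {Γ Δ} → DB → Env Γ → Pattern Γ Δ → Query (Γ ++ Δ) → QFrame
  QStack : Set
  QStack = List QFrame

  data QState : Set where
    st  : DB → DB → QStack → QState
    Ans : DB → QState

  infix 4 _⟶q_
  data _⟶q_ : QState → QState → Set where
    q-fact  : ∀ {F F' Γ} {ρ : Env Γ} {f S} →
              st F F' (qev ρ (fact f) ∷ S) ⟶q st F (instF ρ f ∷ F') S
    q-empty : ∀ {F F' Γ} {ρ : Env Γ} {S} →
              st F F' (qev ρ ∅q ∷ S) ⟶q st F F' S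
    q-plus  : ∀ {F F' Γ} {ρ : Env Γ} {R₁ R₂ S} →
              st F F' (qev ρ (R₁ ⊕ R₂) ∷ S) ⟶q st F F' (qev ρ R₁ ∷ qev ρ R₂ ∷ S)
    q-cond  : ∀ {F F' Γ} {ρ : Env Γ} {φ R S} →
              st F F' (qev ρ (φ ⇒ R) ∷ S) ⟶q st F F' (qcond ρ (ev ρ φ ∷ []) R ∷ S)
    q-cstep : ∀ {F F' Γ} {ρ : Env Γ} {T T' R S} → F ⊢ T ⟶c T' →
              st F F' (qcond ρ T R ∷ S) ⟶q st F F' (qcond ρ T' R ∷ S)
    q-cfalse : ∀ {F F' Γ} {ρ : Env Γ} {R S} →
              st F F' (qcond ρ (Res false ∷ []) R ∷ S) ⟶q st F F' S
    q-ctrue : ∀ {F F' Γ} {ρ : Env Γ} {R S} →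
              st F F' (qcond ρ (Res true ∷ []) R ∷ S) ⟶q st F F' (qev ρ R ∷ S)
    q-from  : ∀ {F F' Γ Δ} {ρ : Env Γ} {P : Pattern Γ Δ} {R S} →
              st F F' (qev ρ (From Δ P R) ∷ S) ⟶q st F F' (qfrom F ρ P R ∷ S)
    q-from-m : ∀ {F F' Γ Δ} {ρ : Env Γ} {P : Pattern Γ Δ} {R G G'' S} (b : Env Δ) →
              Match G ρ P b G'' →
              st F F' (qfrom G ρ P R ∷ S) ⟶q st F F' (qev (++⁺ ρ b) R ∷ qfrom G'' ρ P R ∷ S)
    q-from-n : ∀ {F F' Γ Δ} {ρ : Env Γ} {P : Pattern Γ Δ} {R G S} →
              NoMatch G ρ P →
              st F F' (qfrom G ρ P R ∷ S) ⟶q st F F' S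
    q-done  : ∀ {F F'} → st F F' [] ⟶q Ans F'

  Init : Query [] → DB → QState
  Init Q F = st F [] (qev [] Q ∷ [])

  Irreducible : QState → Set
  Irreducible s = ∀ s' → ¬ (s ⟶q s')

  infix 4 _⟶!_
  _⟶!_ : QState → QState → Set
  s ⟶! u = Star _⟶q_ s u × Irreducible u

-- Tr(R) is built in continuation-passing style: a base relation r becomes a
-- quantification over the facts 𝓡_r(x⃗) with fresh variables x⃗, a selection
-- becomes a guard, a union a sum, a product a nested quantification, and a
-- difference R − S a guard ¬(x⃗ ∈ S) whose membership test is a condition
-- built in the same way; the innermost continuation emits 𝓡_R(x⃗). Every
-- pattern is one base fact over pairwise distinct fresh variables, so the
-- query is closed and deterministic.
--
-- Correctness is split through a denotational semantics of such queries (the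
-- set of facts they emit, a truth value for conditions). By induction on R
-- this semantics agrees with Eval. The query machine computes it: an
-- invariant relating each stack to the facts it will still emit is preserved
-- by every step, which gives soundness of any terminating run, and a run to an
-- answer exists because every database frame can be scanned fact by fact.

{-# OPTIONS --safe #-}
module Submission where

open import Defs
open import Data.List using (List; []; _∷_)
open import Data.List.Relation.Binary.Permutation.Propositional using (_↭_)
open import Data.Product using (Σ; ∃; _×_)
open import Function.Bundles using (_⇔_)

open import Data.Bool using (Bool; true; false; not; _∧_; _∨_; T)
open import Data.Bool.Properties using (T-≡; T-∧; T-∨; ∨-comm)
open import Data.Empty using (⊥; ⊥-elim)
open import Data.Fin using (Fin)
open import Data.Fin.Properties using (suc-injective) renaming (_≟_ to _≟ᶠ_)
open import Data.List using (_++_; map; allFin; [_]; _∷ʳ_)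
open import Data.Bool.ListAction using (any)
open import Data.List.NonEmpty using () renaming ([_] to [_]⁺)
open import Data.List.Properties using (++-identityʳ; ∷ʳ-++)
open import Data.List.Relation.Unary.All using (All; []; _∷_; tabulate) renaming (map to mapAll; lookup to lookupAll)
open import Data.List.Relation.Unary.All.Properties using (++⁺; lookup-map; ∷ʳ⁺)
open import Data.List.Relation.Unary.Any using (Any; here; there; index)
open import Data.List.Relation.Unary.Any.Properties using (any⇔)
open import Data.List.Membership.Propositional using (_∈_; find; lose)
open import Data.List.Membership.Propositional.Properties
  using (∈-++⁺ˡ; ∈-++⁺ʳ; ∈-++⁻; ∈-∃++; ∈-map⁺; ∈-map⁻; ∈-concat⁺′; ∈-concat⁻′; ∈-allFin)
open import Data.List.Relation.Binary.Permutation.Propositional using (↭-sym; ↭-trans)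
open import Data.List.Relation.Binary.Permutation.Propositional.Properties using (∈-resp-↭; shift; ++-comm)
open import Data.Maybe using (Maybe; just; nothing; maybe)
open import Data.Product using (_,_; proj₁; proj₂) renaming (map to mapΣ)
open import Data.Product.Function.NonDependent.Propositional using (_×-⇔_)
open import Data.Sum using (_⊎_; inj₁; inj₂; [_,_]′; assocʳ; assocˡ)
open import Data.Sum.Function.Propositional using (_⊎-⇔_)
open import Data.Unit using (tt)
open import Function using (_∘_; id)
open import Function.Bundles using (mk⇔; Equivalence)
open import Function.Related.TypeIsomorphisms using (¬-cong-⇔)
open import Function.Properties.Equivalence using () renaming (refl to ⇔-refl; sym to ⇔-sym; trans to ⇔-trans)
open import Level using (Lift; lift; lower)
open import Relation.Nullary using (¬_; does; yes; no)
open import Relation.Binary.PropositionalEquality using (_≡_; refl; sym; trans; cong; cong₂; subst)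
open import Relation.Binary.Construct.Closure.ReflexiveTransitive using (Star; ε; _◅_; _◅◅_; gmap)

T-injective : ∀ {x y} → T x ⇔ T y → x ≡ y
T-injective {false} {false} _ = refl
T-injective {false} {true} h = ⊥-elim (Equivalence.from h tt)
T-injective {true} {false} h = ⊥-elim (Equivalence.to h tt)
T-injective {true} {true} _ = refl

T-and : ∀ {x y} → T (not (not x ∨ not y)) ⇔ (T x × T y)
T-and {false} = mk⇔ (λ ()) proj₁
T-and {true} {false} = mk⇔ (λ ()) proj₂
T-and {true} {true} = mk⇔ (λ _ → tt , tt) (λ _ → tt)

T-not : ∀ {x} → T (not x) ⇔ (¬ T x)
T-not {false} = mk⇔ (λ _ ()) (λ _ → tt)
T-not {true} = mk⇔ (λ ()) (λ ¬tt → ¬tt tt)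

⇔-subst : ∀ {A B : Set} (P : B → Set) {x y} → x ≡ y → A ⇔ P x → A ⇔ P y
⇔-subst P refl h = h

∃-cong : ∀ {A : Set} {P Q : A → Set} → (∀ {x} → P x ⇔ Q x) → (∃ P) ⇔ (∃ Q)
∃-cong h = mk⇔ (mapΣ id (Equivalence.to h)) (mapΣ id (Equivalence.from h))

⊎-assoc : ∀ {A B C : Set} → ((A ⊎ B) ⊎ C) ⇔ (A ⊎ (B ⊎ C))
⊎-assoc = mk⇔ assocʳ assocˡ

∈-∷-⊎ : ∀ {A B : Set} {x y : A} {xs} → (x ∈ y ∷ xs ⊎ B) ⇔ (x ∈ xs ⊎ (x ≡ y ⊎ B))
∈-∷-⊎ = mk⇔ (λ { (inj₁ (here e)) → inj₂ (inj₁ e) ; (inj₁ (there x∈)) → inj₁ x∈ ; (inj₂ b) → inj₂ (inj₂ b) })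
            (λ { (inj₁ x∈) → inj₁ (there x∈) ; (inj₂ (inj₁ e)) → inj₁ (here e) ; (inj₂ (inj₂ b)) → inj₂ b })

∷-injective : ∀ {A : Set} {P : A → Set} {x xs} {p q : P x} {ps qs : All P xs} →
  _≡_ {A = All P (x ∷ xs)} (p ∷ ps) (q ∷ qs) → p ≡ q × ps ≡ qs
∷-injective refl = refl , refl

module Translation (D : Domain) (Sch : Schema D) where
  open Domain D
  open Schema Sch
  open Lang D Sch

  Ren : Ctx → Ctx → Set
  Ren Γ Δ = ∀ {s} → s ∈ Γ → s ∈ Δ

  Args : Ctx → List Sort → Set
  Args Γ = All (Term Γ)

  evalArgs : ∀ {Γ ss} → Env Γ → Args Γ ss → Tuple ss
  evalArgs ρ = mapAll (evalT ρ)

  renT : ∀ {Γ Δ s} → Ren Γ Δ → Term Γ s → Term Δ s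
  renT w (var x) = var (w x)
  renT w (val v) = val v

  renArgs : ∀ {Γ Δ ss} → Ren Γ Δ → Args Γ ss → Args Δ ss
  renArgs w = mapAll (renT w)

  subT : ∀ {Δ ss s} → Args Δ ss → Term ss s → Term Δ s
  subT us (var x) = lookupAll us x
  subT us (val v) = val v

  subB : ∀ {Δ ss} → Args Δ ss → BTerm ss → BTerm Δ
  subB us tt = tt
  subB us ff = ff
  subB us (¬b b) = ¬b (subB us b)
  subB us (b ∧b c) = subB us b ∧b subB us c
  subB us (b ∨b c) = subB us b ∨b subB us c
  subB us (t == u) = subT us t == subT us u
  subB us (pred p ts) = pred p (mapAll (subT us) ts)

  projArgs : ∀ {Δ ss ts} → All (_∈ ss) ts → Args Δ ss → Args Δ ts
  projArgs cs us = mapAll (lookupAll us) cs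

  eqArgs : ∀ {Δ ss} → Args Δ ss → Args Δ ss → BTerm Δ
  eqArgs [] [] = tt
  eqArgs (a ∷ as) (b ∷ bs) = (a == b) ∧b eqArgs as bs

  freshVars : ∀ Γ {Δ} → Args (Γ ++ Δ) Δ
  freshVars Γ = tabulate (var ∘ ∈-++⁺ʳ Γ)

  _⊑⟨_⟩_ : ∀ {Γ Δ} → Env Γ → Ren Γ Δ → Env Δ → Set
  ρ ⊑⟨ w ⟩ ρ' = ∀ {s} (x : s ∈ _) → lookupAll ρ' (w x) ≡ lookupAll ρ x

  lookup-++⁺ˡ : ∀ {Γ Δ s} (ρ : Env Γ) (b : Env Δ) (x : s ∈ Γ) →
    lookupAll (++⁺ ρ b) (∈-++⁺ˡ x) ≡ lookupAll ρ x
  lookup-++⁺ˡ (a ∷ ρ) b (here refl) = refl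
  lookup-++⁺ˡ (a ∷ ρ) b (there x) = lookup-++⁺ˡ ρ b x

  lookup-++⁺ʳ : ∀ {Γ Δ s} (ρ : Env Γ) (b : Env Δ) (x : s ∈ Δ) →
    lookupAll (++⁺ ρ b) (∈-++⁺ʳ Γ x) ≡ lookupAll b x
  lookup-++⁺ʳ [] b x = refl
  lookup-++⁺ʳ (a ∷ ρ) b x = lookup-++⁺ʳ ρ b x

  evalArgs-ren : ∀ {Γ Δ ss} {w : Ren Γ Δ} {ρ ρ'} → ρ ⊑⟨ w ⟩ ρ' → (us : Args Γ ss) →
    evalArgs ρ' (renArgs w us) ≡ evalArgs ρ us
  evalArgs-ren ext [] = refl
  evalArgs-ren ext (var x ∷ us) = cong₂ _∷_ (ext x) (evalArgs-ren ext us)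
  evalArgs-ren ext (val v ∷ us) = cong (v ∷_) (evalArgs-ren ext us)

  evalArgs-++⁺ : ∀ {Δ ss ts} (ρ : Env Δ) (us : Args Δ ss) (vs : Args Δ ts) →
    evalArgs ρ (++⁺ us vs) ≡ ++⁺ (evalArgs ρ us) (evalArgs ρ vs)
  evalArgs-++⁺ ρ [] vs = refl
  evalArgs-++⁺ ρ (u ∷ us) vs = cong (evalT ρ u ∷_) (evalArgs-++⁺ ρ us vs)

  evalT-sub : ∀ {Δ ss s} (ρ : Env Δ) (us : Args Δ ss) (t : Term ss s) →
    evalT ρ (subT us t) ≡ evalT (evalArgs ρ us) t
  evalT-sub ρ us (var x) = sym (lookup-map us x)
  evalT-sub ρ us (val v) = refl

  evalArgs-sub : ∀ {Δ ss ts} (ρ : Env Δ) (us : Args Δ ss) (ts : Args ss ts) →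
    evalArgs ρ (mapAll (subT us) ts) ≡ evalArgs (evalArgs ρ us) ts
  evalArgs-sub ρ us [] = refl
  evalArgs-sub ρ us (t ∷ ts) = cong₂ _∷_ (evalT-sub ρ us t) (evalArgs-sub ρ us ts)

  evalB-sub : ∀ {Δ ss} (ρ : Env Δ) (us : Args Δ ss) (θ : BTerm ss) →
    evalB ρ (subB us θ) ≡ evalB (evalArgs ρ us) θ
  evalB-sub ρ us tt = refl
  evalB-sub ρ us ff = refl
  evalB-sub ρ us (¬b θ) = cong not (evalB-sub ρ us θ)
  evalB-sub ρ us (θ ∧b φ) = cong₂ _∧_ (evalB-sub ρ us θ) (evalB-sub ρ us φ)
  evalB-sub ρ us (θ ∨b φ) = cong₂ _∨_ (evalB-sub ρ us θ) (evalB-sub ρ us φ)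
  evalB-sub ρ us (t == u) rewrite evalT-sub ρ us t | evalT-sub ρ us u = refl
  evalB-sub ρ us (pred p ts) = cong ⟦ p ⟧P (evalArgs-sub ρ us ts)

  evalArgs-proj : ∀ {Δ ss ts} (ρ : Env Δ) (cs : All (_∈ ss) ts) (us : Args Δ ss) →
    evalArgs ρ (projArgs cs us) ≡ project cs (evalArgs ρ us)
  evalArgs-proj ρ [] us = refl
  evalArgs-proj ρ (c ∷ cs) us = cong₂ _∷_ (sym (lookup-map us c)) (evalArgs-proj ρ cs us)

  evalArgs-tabulate-var : ∀ {Θ Δ} {h : Ren Δ Θ} {σ : Env Θ} (b : Env Δ) →
    b ⊑⟨ h ⟩ σ → evalArgs σ (tabulate (var ∘ h)) ≡ b
  evalArgs-tabulate-var [] ext = refl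
  evalArgs-tabulate-var (v ∷ b) ext =
    cong₂ _∷_ (ext (here refl)) (evalArgs-tabulate-var b (ext ∘ there))

  evalArgs-freshVars : ∀ {Γ Δ} (ρ : Env Γ) (b : Env Δ) → evalArgs (++⁺ ρ b) (freshVars Γ) ≡ b
  evalArgs-freshVars ρ b = evalArgs-tabulate-var b (lookup-++⁺ʳ ρ b)

  T-does-≟ : ∀ {s} (x y : Val s) → T (does (x ≟v y)) ⇔ x ≡ y
  T-does-≟ x y with x ≟v y
  ... | yes x≡y = mk⇔ (λ _ → x≡y) (λ _ → tt)
  ... | no x≢y = mk⇔ (λ ()) (λ x≡y → x≢y x≡y)

  T-eqArgs : ∀ {Δ ss} (ρ : Env Δ) (as bs : Args Δ ss) →
    T (evalB ρ (eqArgs as bs)) ⇔ evalArgs ρ as ≡ evalArgs ρ bs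
  T-eqArgs ρ [] [] = mk⇔ (λ _ → refl) (λ _ → tt)
  T-eqArgs ρ (a ∷ as) (b ∷ bs) = mk⇔
    (λ h → let h₁ , h₂ = Equivalence.to T-∧ h in
           cong₂ _∷_ (Equivalence.to (T-does-≟ _ _) h₁) (Equivalence.to (T-eqArgs ρ as bs) h₂))
    (λ e → let e₁ , e₂ = ∷-injective e in
           Equivalence.from T-∧ (Equivalence.from (T-does-≟ _ _) e₁ , Equivalence.from (T-eqArgs ρ as bs) e₂))

  -- The fragment of the query language used by the translation: every
  -- quantification pattern is a single ?-block holding one base fact whose
  -- arguments are exactly the newly bound variables.
  basePattern : ∀ {Γ} (r : Fin nRel) → Pattern Γ (arity r)
  basePattern {Γ} r = record { bang = [] ; ques = [ base r ⦅ freshVars Γ ⦆ ]⁺ }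

  data FCond (Γ : Ctx) : Set where
    atom : BTerm Γ → FCond Γ
    neg  : FCond Γ → FCond Γ
    or   : FCond Γ → FCond Γ → FCond Γ
    ex   : (r : Fin nRel) → FCond (Γ ++ arity r) → FCond Γ

  and : ∀ {Γ} → FCond Γ → FCond Γ → FCond Γ
  and ψ φ = neg (or (neg ψ) (neg φ))

  data FQuery (Γ : Ctx) : Set where
    emit  : FactT Γ → FQuery Γ
    plus  : FQuery Γ → FQuery Γ → FQuery Γ
    guard : FCond Γ → FQuery Γ → FQuery Γ
    from  : (r : Fin nRel) → FQuery (Γ ++ arity r) → FQuery Γ

  ⌊_⌋c : ∀ {Γ} → FCond Γ → Cond Γ
  ⌊ atom B ⌋c = ⟨ B ⟩
  ⌊ neg ψ ⌋c = ¬c ⌊ ψ ⌋c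
  ⌊ or ψ φ ⌋c = ⌊ ψ ⌋c ∨c ⌊ φ ⌋c
  ⌊ ex r ψ ⌋c = ∃c (arity r) (basePattern r) ⌊ ψ ⌋c

  ⌊_⌋q : ∀ {Γ} → FQuery Γ → Query Γ
  ⌊ emit f ⌋q = fact f
  ⌊ plus Q R ⌋q = ⌊ Q ⌋q ⊕ ⌊ R ⌋q
  ⌊ guard φ Q ⌋q = ⌊ φ ⌋c ⇒ ⌊ Q ⌋q
  ⌊ from r Q ⌋q = From (arity r) (basePattern r) ⌊ Q ⌋q

  occurs-tabulate : ∀ {Γ Δ} (h : ∀ {s} → s ∈ Δ → Term Γ s) {s s'} (z : s' ∈ Γ) (x : s ∈ Δ) →
    OccT z (h x) → OccArgs z (tabulate h)
  occurs-tabulate h z (here refl) o = inj₁ o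
  occurs-tabulate h z (there x) o = inj₂ (occurs-tabulate (h ∘ there) z x o)

  basePattern-bindsAll : ∀ {Γ} (r : Fin nRel) → BindsAll (basePattern {Γ} r)
  basePattern-bindsAll {Γ} r x = here (occurs-tabulate (var ∘ ∈-++⁺ʳ Γ) (∈-++⁺ʳ Γ x) x refl)

  lookup-cong-index : ∀ {Γ s s'} (x : s ∈ Γ) (y : s' ∈ Γ) (ρ ρ' : Env Γ) →
    index x ≡ index y → lookupAll ρ y ≡ lookupAll ρ' y → lookupAll ρ x ≡ lookupAll ρ' x
  lookup-cong-index (here refl) (here refl) (_ ∷ _) (_ ∷ _) _ e = e
  lookup-cong-index (there x) (there y) (_ ∷ ρ) (_ ∷ ρ') i e =
    lookup-cong-index x y ρ ρ' (suc-injective i) e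

  lookup-determined : ∀ {Γ s ss} (x : s ∈ Γ) (ts : Args Γ ss) (ρ ρ' : Env Γ) →
    OccArgs x ts → evalArgs ρ ts ≡ evalArgs ρ' ts → lookupAll ρ x ≡ lookupAll ρ' x
  lookup-determined x (var y ∷ ts) ρ ρ' (inj₁ o) e = lookup-cong-index x y ρ ρ' o (proj₁ (∷-injective e))
  lookup-determined x (t ∷ ts) ρ ρ' (inj₂ o) e = lookup-determined x ts ρ ρ' o (proj₂ (∷-injective e))

  ⦅⦆-injective : ∀ {ss} (R : RA ss) {a b : Tuple ss} → GFact._⦅_⦆ R a ≡ R ⦅ b ⦆ → a ≡ b
  ⦅⦆-injective R refl = refl

  basePattern-deterministic : ∀ {Γ} (r : Fin nRel) → DetPat (basePattern {Γ} r)
  basePattern-deterministic {Γ} r = _ , refl , λ ρ ρ' e x o →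
    lookup-determined x (freshVars Γ) ρ ρ' o (⦅⦆-injective (base r) e)

  closedC : ∀ {Γ} (ψ : FCond Γ) → WFC ⌊ ψ ⌋c
  closedC (atom B) = tt
  closedC (neg ψ) = closedC ψ
  closedC (or ψ φ) = closedC ψ , closedC φ
  closedC (ex r ψ) = basePattern-bindsAll r , closedC ψ

  closedQ : ∀ {Γ} (Q : FQuery Γ) → WFQ ⌊ Q ⌋q
  closedQ (emit f) = tt
  closedQ (plus Q R) = closedQ Q , closedQ R
  closedQ (guard φ Q) = closedC φ , closedQ Q
  closedQ (from r Q) = basePattern-bindsAll r , closedQ Q

  deterministicC : ∀ {Γ} (ψ : FCond Γ) → DetC ⌊ ψ ⌋c
  deterministicC (atom B) = tt
  deterministicC (neg ψ) = deterministicC ψ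
  deterministicC (or ψ φ) = deterministicC ψ , deterministicC φ
  deterministicC (ex r ψ) = basePattern-deterministic r , deterministicC ψ

  deterministicQ : ∀ {Γ} (Q : FQuery Γ) → Deterministic ⌊ Q ⌋q
  deterministicQ (emit f) = tt
  deterministicQ (plus Q R) = deterministicQ Q , deterministicQ R
  deterministicQ (guard φ Q) = deterministicC φ , deterministicQ Q
  deterministicQ (from r Q) = basePattern-deterministic r , deterministicQ Q

  baseArgs : (r : Fin nRel) → GFact → Maybe (Tuple (arity r))
  baseArgs r (base r' ⦅ t ⦆) with r' ≟ᶠ r
  ... | yes refl = just t
  ... | no _ = nothing
  baseArgs r _ = nothing

  baseArgs-base : ∀ r (t : Tuple (arity r)) → baseArgs r (base r ⦅ t ⦆) ≡ just t
  baseArgs-base r t with r ≟ᶠ r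
  ... | yes refl = refl
  ... | no r≢r = ⊥-elim (r≢r refl)

  baseArgs-just : ∀ r g {b : Tuple (arity r)} → baseArgs r g ≡ just b → g ≡ base r ⦅ b ⦆
  baseArgs-just r (base r' ⦅ t ⦆) e with r' ≟ᶠ r
  baseArgs-just r (base r' ⦅ t ⦆) refl | yes refl = refl
  baseArgs-just r (base r' ⦅ t ⦆) () | no _
  baseArgs-just r (proj _ _ ⦅ _ ⦆) ()
  baseArgs-just r (sel _ _ ⦅ _ ⦆) ()
  baseArgs-just r (union _ _ ⦅ _ ⦆) ()
  baseArgs-just r (prod _ _ ⦅ _ ⦆) ()
  baseArgs-just r (diff _ _ ⦅ _ ⦆) ()

  instF-freshVars : ∀ {Γ} r (ρ : Env Γ) (b : Tuple (arity r)) →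
    instF (++⁺ ρ b) (base r ⦅ freshVars Γ ⦆) ≡ base r ⦅ b ⦆
  instF-freshVars r ρ b = cong (base r ⦅_⦆) (evalArgs-freshVars ρ b)

  -- An equation base r ⦅ b ⦆ ≡ base r' ⦅ t ⦆ cannot be split by pattern
  -- matching (arity is not injective), so it is decoded through baseArgs.
  baseArgs-transport : (P : (r : Fin nRel) → Tuple (arity r) → Set) →
    ∀ {r r'} {b : Tuple (arity r)} {t : Tuple (arity r')} →
    baseArgs r (base r' ⦅ t ⦆) ≡ just b → P r' t → P r b
  baseArgs-transport P {r} {r'} e p with r' ≟ᶠ r
  baseArgs-transport P refl p | yes refl = p
  baseArgs-transport P () p | no _

  base-∈-Trb : ∀ (I : Instance) r (b : Tuple (arity r)) → base r ⦅ b ⦆ ∈ Trb I ⇔ b ∈ I r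
  base-∈-Trb I r b = mk⇔ to (λ b∈ → ∈-concat⁺′ (∈-map⁺ (base r ⦅_⦆) b∈) (∈-map⁺ facts (∈-allFin r)))
    where
      facts : Fin nRel → DB
      facts r = map (base r ⦅_⦆) (I r)

      to : base r ⦅ b ⦆ ∈ Trb I → b ∈ I r
      to b∈ with ∈-concat⁻′ (map facts (allFin nRel)) b∈
      ... | _ , b∈facts , facts∈ with ∈-map⁻ facts facts∈
      ...   | r' , _ , refl with ∈-map⁻ (base r' ⦅_⦆) b∈facts
      ...     | t , t∈ , e =
        baseArgs-transport (λ r b → b ∈ I r) (trans (cong (baseArgs r) (sym e)) (baseArgs-base r b)) t∈

  ∈-match : ∀ {Γ r G G''} {ρ : Env Γ} {b : Tuple (arity r)} → Match G ρ (basePattern r) b G'' →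
    ∀ {g} → g ∈ G ⇔ (g ≡ base r ⦅ b ⦆ ⊎ g ∈ G'')
  ∈-match {r = r} {ρ = ρ} {b} (G' , G↭ , refl) rewrite instF-freshVars r ρ b | ++-identityʳ G' =
    mk⇔ (split ∘ ∈-++⁻ G' ∘ ∈-resp-↭ G↭) (∈-resp-↭ (↭-sym G↭) ∘ join)
    where
      split : ∀ {g} → g ∈ G' ⊎ g ∈ [ base r ⦅ b ⦆ ] → g ≡ base r ⦅ b ⦆ ⊎ g ∈ G'
      split (inj₁ g∈G') = inj₂ g∈G'
      split (inj₂ (here g≡)) = inj₁ g≡
      join : ∀ {g} → g ≡ base r ⦅ b ⦆ ⊎ g ∈ G' → g ∈ G' ++ [ base r ⦅ b ⦆ ]
      join (inj₁ refl) = ∈-++⁺ʳ G' (here refl)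
      join (inj₂ g∈G') = ∈-++⁺ˡ g∈G'

  ∃∈-match : ∀ {Γ r G G''} {ρ : Env Γ} {b : Tuple (arity r)} → Match G ρ (basePattern r) b G'' →
    (P : Tuple (arity r) → Set) →
    (∃ λ b' → base r ⦅ b' ⦆ ∈ G × P b') ⇔ (P b ⊎ ∃ λ b' → base r ⦅ b' ⦆ ∈ G'' × P b')
  ∃∈-match {r = r} {G} {G''} {b = b} m P = mk⇔ to fro
    where
      to : (∃ λ b' → base r ⦅ b' ⦆ ∈ G × P b') → P b ⊎ ∃ λ b' → base r ⦅ b' ⦆ ∈ G'' × P b'
      to (b' , b'∈ , p) with Equivalence.to (∈-match {b = b} m) b'∈
      ... | inj₁ e = inj₁ (subst P (⦅⦆-injective (base r) e) p)
      ... | inj₂ b'∈G'' = inj₂ (b' , b'∈G'' , p)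
      fro : P b ⊎ (∃ λ b' → base r ⦅ b' ⦆ ∈ G'' × P b') → ∃ λ b' → base r ⦅ b' ⦆ ∈ G × P b'
      fro (inj₁ p) = b , Equivalence.from (∈-match {b = b} m) (inj₁ refl) , p
      fro (inj₂ (b' , b'∈G'' , p)) = b' , Equivalence.from (∈-match {b = b} m) (inj₂ b'∈G'') , p

  match-split : ∀ {Γ r} {ρ : Env Γ} {b : Tuple (arity r)} (ys zs : DB) →
    Match (ys ++ base r ⦅ b ⦆ ∷ zs) ρ (basePattern r) b ((ys ++ zs) ++ [])
  match-split {r = r} {ρ} {b} ys zs rewrite sym (instF-freshVars r ρ b) =
    ys ++ zs , ↭-trans (shift _ ys zs) (++-comm [ _ ] (ys ++ zs)) , refl

  match-∈ : ∀ {Γ r G} {ρ : Env Γ} {b : Tuple (arity r)} → base r ⦅ b ⦆ ∈ G →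
    ∃ λ G'' → Match G ρ (basePattern r) b G''
  match-∈ b∈G with ∈-∃++ b∈G
  ... | ys , zs , refl = _ , match-split ys zs

  noMatch-∉ : ∀ {Γ r G} {ρ : Env Γ} → NoMatch G ρ (basePattern r) →
    ∀ {b} → ¬ base r ⦅ b ⦆ ∈ G
  noMatch-∉ nm b∈G = nm (_ , match-∈ b∈G)

  NoBase : Fin nRel → DB → Set
  NoBase r = All (λ g → baseArgs r g ≡ nothing)

  noMatch-NoBase : ∀ {Γ r G} {ρ : Env Γ} → NoBase r G → NoMatch G ρ (basePattern r)
  noMatch-NoBase {r = r} {ρ = ρ} noBase (b , _ , m) =
    just≢nothing (trans (sym (baseArgs-base r b))
                        (lookupAll noBase (Equivalence.from (∈-match {ρ = ρ} {b} m) (inj₁ refl))))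
    where
      just≢nothing : ∀ {A : Set} {a : A} → ¬ just a ≡ nothing
      just≢nothing ()

  module Semantics (F : DB) where

    mutual
      holds : ∀ {Γ} → Env Γ → FCond Γ → Bool
      holds ρ (atom B) = evalB ρ B
      holds ρ (neg ψ) = not (holds ρ ψ)
      holds ρ (or ψ φ) = holds ρ ψ ∨ holds ρ φ
      holds ρ (ex r ψ) = witnessIn ρ r ψ F

      witnessIn : ∀ {Γ} → Env Γ → (r : Fin nRel) → FCond (Γ ++ arity r) → DB → Bool
      witnessIn ρ r ψ = any (maybe (λ b → holds (++⁺ ρ b) ψ) false ∘ baseArgs r)

    T-witnessIn : ∀ {Γ} (ρ : Env Γ) r (ψ : FCond (Γ ++ arity r)) G →
      T (witnessIn ρ r ψ G) ⇔ (∃ λ b → base r ⦅ b ⦆ ∈ G × T (holds (++⁺ ρ b) ψ))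
    T-witnessIn ρ r ψ G = mk⇔ (witness ∘ find ∘ Equivalence.from any⇔) (Equivalence.to any⇔ ∘ found)
      where
        holdsAt : GFact → Bool
        holdsAt = maybe (λ b → holds (++⁺ ρ b) ψ) false ∘ baseArgs r

        witness : (∃ λ g → g ∈ G × T (holdsAt g)) → ∃ λ b → base r ⦅ b ⦆ ∈ G × T (holds (++⁺ ρ b) ψ)
        witness (g , g∈G , h) with baseArgs r g in eq
        ... | just b = b , subst (_∈ G) (baseArgs-just r g eq) g∈G , h

        found : (∃ λ b → base r ⦅ b ⦆ ∈ G × T (holds (++⁺ ρ b) ψ)) → Any (T ∘ holdsAt) G
        found (b , b∈G , h) = lose b∈G (subst (T ∘ maybe _ false) (sym (baseArgs-base r b)) h)

    mutual
      Emits : ∀ {Γ} → Env Γ → FQuery Γ → GFact → Set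
      Emits ρ (emit f) g = g ≡ instF ρ f
      Emits ρ (plus Q R) g = Emits ρ Q g ⊎ Emits ρ R g
      Emits ρ (guard φ Q) g = T (holds ρ φ) × Emits ρ Q g
      Emits ρ (from r Q) g = EmitsFrom ρ r Q F g

      EmitsFrom : ∀ {Γ} → Env Γ → (r : Fin nRel) → FQuery (Γ ++ arity r) → DB → GFact → Set
      EmitsFrom ρ r Q G g = ∃ λ b → base r ⦅ b ⦆ ∈ G × Emits (++⁺ ρ b) Q g

    witnessIn-match : ∀ {Γ r G G''} {ρ : Env Γ} {ψ : FCond (Γ ++ arity r)} {b} →
      Match G ρ (basePattern r) b G'' →
      witnessIn ρ r ψ G ≡ holds (++⁺ ρ b) ψ ∨ witnessIn ρ r ψ G''
    witnessIn-match {G = G} {G''} {ρ} {ψ} {b} m = T-injective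
      (⇔-trans (T-witnessIn ρ _ ψ G)
      (⇔-trans (∃∈-match m _)
      (⇔-trans (⇔-refl ⊎-⇔ ⇔-sym (T-witnessIn ρ _ ψ G''))
               (⇔-sym T-∨))))

    witnessIn-noMatch : ∀ {Γ r G} {ρ : Env Γ} {ψ : FCond (Γ ++ arity r)} →
      NoMatch G ρ (basePattern r) → witnessIn ρ r ψ G ≡ false
    witnessIn-noMatch {G = G} {ρ} {ψ} nm = T-injective (mk⇔ absurd λ ())
      where
        absurd : T (witnessIn ρ _ ψ G) → ⊥
        absurd h = let _ , b∈G , _ = Equivalence.to (T-witnessIn ρ _ ψ G) h in noMatch-∉ nm b∈G

  module ConditionMachine (F : DB) where
    open Semantics F

    -- Kont K k: once the frames above K produce Res b, the stack K produces Res (k b).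
    data Kont : CStack → (Bool → Bool) → Set where
      []  : Kont [] id
      not∷ : ∀ {K k} → Kont K k → Kont (Not ∷ K) (k ∘ not)
      or∷ : ∀ {Γ K k} (ρ : Env Γ) (ψ : FCond Γ) → Kont K k →
            Kont (ev↓ ρ ⌊ ψ ⌋c ∷ K) (λ b → k (b ∨ holds ρ ψ))
      ex∷ : ∀ {Γ K k} (ρ : Env Γ) r (ψ : FCond (Γ ++ arity r)) G → Kont K k →
            Kont (exf G ρ (basePattern r) ⌊ ψ ⌋c ∷ K) (λ b → k (b ∨ witnessIn ρ r ψ G))

    data Yields : CStack → Bool → Set where
      res : ∀ {K k} b → Kont K k → Yields (Res b ∷ K) (k b)
      ev  : ∀ {Γ K k} (ρ : Env Γ) (ψ : FCond Γ) → Kont K k → Yields (ev ρ ⌊ ψ ⌋c ∷ K) (k (holds ρ ψ))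
      exf : ∀ {Γ K k} (ρ : Env Γ) r (ψ : FCond (Γ ++ arity r)) G → Kont K k →
            Yields (exf G ρ (basePattern r) ⌊ ψ ⌋c ∷ K) (k (witnessIn ρ r ψ G))

    yields-step : ∀ {T T' v} → Yields T v → F ⊢ T ⟶c T' → Yields T' v
    yields-step (res b (not∷ κ)) r-not = res (not b) κ
    yields-step (res true (or∷ ρ ψ κ)) r-or-t = res true κ
    yields-step (res false (or∷ ρ ψ κ)) r-or-f = ev ρ ψ κ
    yields-step (res true (ex∷ ρ r ψ G κ)) r-ex-t = res true κ
    yields-step (res false (ex∷ ρ r ψ G κ)) r-ex-f = exf ρ r ψ G κ
    yields-step (ev ρ (atom B) κ) r-atom = res (evalB ρ B) κ
    yields-step (ev ρ (neg ψ) κ) r-neg = ev ρ ψ (not∷ κ)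
    yields-step (ev {k = k} ρ (or ψ φ) κ) r-or =
      subst (Yields _) (cong k (∨-comm (holds ρ φ) (holds ρ ψ))) (ev ρ φ (or∷ ρ ψ κ))
    yields-step (ev ρ (ex r ψ) κ) r-ex = exf ρ r ψ F κ
    yields-step (exf {k = k} ρ r ψ G κ) (r-ex-m b m) =
      subst (Yields _) (cong k (sym (witnessIn-match {ρ = ρ} {ψ} m))) (ev (++⁺ ρ b) ψ (ex∷ ρ r ψ _ κ))
    yields-step (exf {k = k} ρ r ψ G κ) (r-ex-n nm) =
      subst (Yields _) (cong k (sym (witnessIn-noMatch {ρ = ρ} {ψ} nm))) (res false κ)

    yields-result : ∀ {b v} → Yields (Res b ∷ []) v → v ≡ b
    yields-result (res b []) = refl

    CRun : CStack → CStack → Set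
    CRun = Star (F ⊢_⟶c_)

    -- A frame [G | a]_{∃P.ψ} is run by scanning G = acc ++ rest, where acc
    -- holds the facts already passed over because they are not r-facts.
    mutual
      ev-terminates : ∀ {Γ} (ρ : Env Γ) (ψ : FCond Γ) T → ∃ λ v → CRun (ev ρ ⌊ ψ ⌋c ∷ T) (Res v ∷ T)
      ev-terminates ρ (atom B) T = _ , r-atom ◅ ε
      ev-terminates ρ (neg ψ) T =
        let v , run = ev-terminates ρ ψ (Not ∷ T) in not v , r-neg ◅ (run ◅◅ (r-not ◅ ε))
      ev-terminates ρ (or ψ φ) T with ev-terminates ρ φ (ev↓ ρ ⌊ ψ ⌋c ∷ T)
      ... | true , run = true , r-or ◅ (run ◅◅ (r-or-t ◅ ε))
      ... | false , run =
        let v , run' = ev-terminates ρ ψ T in v , r-or ◅ (run ◅◅ (r-or-f ◅ run'))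
      ev-terminates ρ (ex r ψ) T =
        let v , run = exf-terminates ρ r ψ T [] F refl [] in v , r-ex ◅ run

      exf-terminates : ∀ {Γ} (ρ : Env Γ) r (ψ : FCond (Γ ++ arity r)) T {G} acc rest →
        G ≡ acc ++ rest → NoBase r acc →
        ∃ λ v → CRun (exf G ρ (basePattern r) ⌊ ψ ⌋c ∷ T) (Res v ∷ T)
      exf-terminates ρ r ψ T acc [] eq noBase =
        false , r-ex-n (noMatch-NoBase (subst (NoBase r) (sym (trans eq (++-identityʳ acc))) noBase)) ◅ ε
      exf-terminates ρ r ψ T acc (g ∷ rest) refl noBase with baseArgs r g in isBase
      ... | nothing =
        exf-terminates ρ r ψ T (acc ∷ʳ g) rest (sym (∷ʳ-++ acc g rest)) (∷ʳ⁺ noBase isBase)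
      ... | just b with baseArgs-just r g isBase
      ...   | refl with ev-terminates (++⁺ ρ b) ψ (exf ((acc ++ rest) ++ []) ρ (basePattern r) ⌊ ψ ⌋c ∷ T)
      ...     | true , run = true , r-ex-m b (match-split acc rest) ◅ (run ◅◅ (r-ex-t ◅ ε))
      ...     | false , run =
        let v , run' = exf-terminates ρ r ψ T acc rest (++-identityʳ _) noBase
        in v , r-ex-m b (match-split acc rest) ◅ (run ◅◅ (r-ex-f ◅ run'))

  module QueryMachine (F : DB) where
    open Semantics F
    open ConditionMachine F

    -- Pending S M: the frames of S will still add to the answer exactly the facts satisfying M.
    data Pending : QStack → (GFact → Set) → Set₁ where
      []    : Pending [] (λ _ → ⊥)
      ev∷   : ∀ {Γ S M} (ρ : Env Γ) (Q : FQuery Γ) → Pending S M →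
              Pending (qev ρ ⌊ Q ⌋q ∷ S) (λ g → Emits ρ Q g ⊎ M g)
      cond∷ : ∀ {Γ K v S M} (ρ : Env Γ) (Q : FQuery Γ) → Yields K v → Pending S M →
              Pending (qcond ρ K ⌊ Q ⌋q ∷ S) (λ g → (T v × Emits ρ Q g) ⊎ M g)
      from∷ : ∀ {Γ S M} (ρ : Env Γ) r (Q : FQuery (Γ ++ arity r)) G → Pending S M →
              Pending (qfrom G ρ (basePattern r) ⌊ Q ⌋q ∷ S) (λ g → EmitsFrom ρ r Q G g ⊎ M g)

    Invariant : (GFact → Set) → QState → Set₁
    Invariant Out (st F₀ F' S) =
      F₀ ≡ F × Σ (GFact → Set) λ M → Pending S M × (∀ g → (g ∈ F' ⊎ M g) ⇔ Out g)
    Invariant Out (Ans F') = Lift _ (∀ g → g ∈ F' ⇔ Out g)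

    invariant-cong : ∀ {Out Out' s} → (∀ g → Out g ⇔ Out' g) → Invariant Out s → Invariant Out' s
    invariant-cong {s = st _ _ _} out (e , M , p , h) = e , M , p , λ g → ⇔-trans (h g) (out g)
    invariant-cong {s = Ans _} out (lift h) = lift λ g → ⇔-trans (h g) (out g)

    step-preserves : ∀ {F' S M s} → Pending S M → st F F' S ⟶q s → Invariant (λ g → g ∈ F' ⊎ M g) s
    step-preserves [] q-done = lift λ g → mk⇔ inj₁ [ id , ⊥-elim ]′
    step-preserves (ev∷ ρ (emit f) p) q-fact = refl , _ , p , λ g → ∈-∷-⊎
    step-preserves (ev∷ ρ (plus Q R) p) q-plus =
      refl , _ , ev∷ ρ Q (ev∷ ρ R p) , λ g → ⇔-refl ⊎-⇔ ⇔-sym ⊎-assoc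
    step-preserves (ev∷ ρ (guard φ Q) p) q-cond = refl , _ , cond∷ ρ Q (ev ρ φ []) p , λ g → ⇔-refl
    step-preserves (ev∷ ρ (from r Q) p) q-from = refl , _ , from∷ ρ r Q F p , λ g → ⇔-refl
    step-preserves (cond∷ ρ Q y p) (q-cstep s) = refl , _ , cond∷ ρ Q (yields-step y s) p , λ g → ⇔-refl
    step-preserves (cond∷ ρ Q y p) q-cfalse with yields-result y
    ... | refl = refl , _ , p , λ g → ⇔-refl ⊎-⇔ mk⇔ inj₂ [ (λ ()) ∘ proj₁ , id ]′
    step-preserves (cond∷ ρ Q y p) q-ctrue with yields-result y
    ... | refl = refl , _ , ev∷ ρ Q p , λ g → ⇔-refl ⊎-⇔ (mk⇔ (tt ,_) proj₂ ⊎-⇔ ⇔-refl)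
    step-preserves (from∷ ρ r Q G p) (q-from-m b m) =
      refl , _ , ev∷ (++⁺ ρ b) Q (from∷ ρ r Q _ p) ,
      λ g → ⇔-refl ⊎-⇔
              ⇔-trans (⇔-sym ⊎-assoc) (⇔-sym (∃∈-match m (λ b' → Emits (++⁺ ρ b') Q g)) ⊎-⇔ ⇔-refl)
    step-preserves (from∷ ρ r Q G p) (q-from-n nm) =
      refl , _ , p , λ g → ⇔-refl ⊎-⇔ mk⇔ inj₂ [ (λ { (_ , b∈G , _) → ⊥-elim (noMatch-∉ nm b∈G) }) , id ]′

    invariant-step : ∀ {Out s s'} → Invariant Out s → s ⟶q s' → Invariant Out s'
    invariant-step {s = st _ _ _} (refl , M , p , out) step = invariant-cong out (step-preserves p step)

    QRun : QState → QState → Set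
    QRun = Star _⟶q_

    invariant-run : ∀ {Out s s'} → Invariant Out s → QRun s s' → Invariant Out s'
    invariant-run i ε = i
    invariant-run i (s ◅ ss) = invariant-run (invariant-step i s) ss

    mutual
      qev-terminates : ∀ {Γ} (ρ : Env Γ) (Q : FQuery Γ) F' S →
        ∃ λ F'' → QRun (st F F' (qev ρ ⌊ Q ⌋q ∷ S)) (st F F'' S)
      qev-terminates ρ (emit f) F' S = _ , q-fact ◅ ε
      qev-terminates ρ (plus Q R) F' S =
        let F₁ , run₁ = qev-terminates ρ Q F' (qev ρ ⌊ R ⌋q ∷ S)
            F₂ , run₂ = qev-terminates ρ R F₁ S
        in F₂ , q-plus ◅ (run₁ ◅◅ run₂)
      qev-terminates ρ (guard φ Q) F' S with ev-terminates ρ φ []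
      ... | true , run =
        let F'' , run' = qev-terminates ρ Q F' S in F'' , q-cond ◅ (inCond run ◅◅ (q-ctrue ◅ run'))
        where inCond = gmap (λ T → st F F' (qcond ρ T ⌊ Q ⌋q ∷ S)) q-cstep
      ... | false , run = F' , q-cond ◅ (inCond run ◅◅ (q-cfalse ◅ ε))
        where inCond = gmap (λ T → st F F' (qcond ρ T ⌊ Q ⌋q ∷ S)) q-cstep
      qev-terminates ρ (from r Q) F' S =
        let F'' , run = qfrom-terminates ρ r Q F' S [] F refl [] in F'' , q-from ◅ run

      qfrom-terminates : ∀ {Γ} (ρ : Env Γ) r (Q : FQuery (Γ ++ arity r)) F' S {G} acc rest →
        G ≡ acc ++ rest → NoBase r acc →
        ∃ λ F'' → QRun (st F F' (qfrom G ρ (basePattern r) ⌊ Q ⌋q ∷ S)) (st F F'' S)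
      qfrom-terminates ρ r Q F' S acc [] eq noBase =
        F' , q-from-n (noMatch-NoBase (subst (NoBase r) (sym (trans eq (++-identityʳ acc))) noBase)) ◅ ε
      qfrom-terminates ρ r Q F' S acc (g ∷ rest) refl noBase with baseArgs r g in isBase
      ... | nothing =
        qfrom-terminates ρ r Q F' S (acc ∷ʳ g) rest (sym (∷ʳ-++ acc g rest)) (∷ʳ⁺ noBase isBase)
      ... | just b with baseArgs-just r g isBase
      ...   | refl =
        let F₁ , run₁ = qev-terminates (++⁺ ρ b) Q F'
                          (qfrom ((acc ++ rest) ++ []) ρ (basePattern r) ⌊ Q ⌋q ∷ S)
            F₂ , run₂ = qfrom-terminates ρ r Q F₁ S acc rest (++-identityʳ _) noBase
        in F₂ , q-from-m b (match-split acc rest) ◅ (run₁ ◅◅ run₂)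

    query-terminates : (Q : FQuery []) → ∃ λ F' → QRun (Init ⌊ Q ⌋q F) (Ans F')
    query-terminates Q = let F' , run = qev-terminates [] Q [] [] in F' , run ◅◅ (q-done ◅ ε)

    query-answer : (Q : FQuery []) → ∀ {F'} → QRun (Init ⌊ Q ⌋q F) (Ans F') →
      ∀ g → g ∈ F' ⇔ Emits [] Q g
    query-answer Q run = lower (invariant-run initial run)
      where
        initial : Invariant (Emits [] Q) (Init ⌊ Q ⌋q F)
        initial = refl , _ , ev∷ [] Q [] , λ g → mk⇔ [ (λ ()) , [ id , ⊥-elim ]′ ]′ (inj₂ ∘ inj₁)

  record Formers (X : Ctx → Set) : Set where
    field
      fromX  : ∀ {Γ} r → X (Γ ++ arity r) → X Γ
      unionX : ∀ {Γ} → X Γ → X Γ → X Γ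
      guardX : ∀ {Γ} → FCond Γ → X Γ → X Γ
  open Formers

  condFormers : Formers FCond
  condFormers = record { fromX = ex ; unionX = or ; guardX = and }

  queryFormers : Formers FQuery
  queryFormers = record { fromX = from ; unionX = plus ; guardX = guard }

  -- forEach 𝔛 R k ranges over the tuples u of R and continues with k, which
  -- receives the columns of u as terms over the context extended by the
  -- variables bound so far.
  Cont : (Ctx → Set) → Ctx → List Sort → Set
  Cont X Γ ss = ∀ {Δ} → Ren Γ Δ → Args Δ ss → X Δ

  mutual
    forEach : ∀ {X Γ ss} → Formers X → RA ss → Cont X Γ ss → X Γ
    forEach {Γ = Γ} 𝔛 (base r) k = fromX 𝔛 r (k ∈-++⁺ˡ (freshVars Γ))
    forEach 𝔛 (proj cs R) k = forEach 𝔛 R λ w us → k w (projArgs cs us)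
    forEach 𝔛 (sel θ R) k = forEach 𝔛 R λ w us → guardX 𝔛 (atom (subB us θ)) (k w us)
    forEach 𝔛 (union R S) k = unionX 𝔛 (forEach 𝔛 R k) (forEach 𝔛 S k)
    forEach 𝔛 (prod R S) k =
      forEach 𝔛 R λ w us → forEach 𝔛 S λ w' vs → k (w' ∘ w) (++⁺ (renArgs w' us) vs)
    forEach 𝔛 (diff R S) k = forEach 𝔛 R λ w us → guardX 𝔛 (neg (memberOf S us)) (k w us)

    memberOf : ∀ {Δ ss} → RA ss → Args Δ ss → FCond Δ
    memberOf S us = forEach condFormers S λ w vs → atom (eqArgs vs (renArgs w us))

  translate : ∀ {ss} → RA ss → FQuery []
  translate R = forEach queryFormers R λ _ us → emit (R ⦅ us ⦆)

  module Soundness (I : Instance) where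
    open Semantics (Trb I)

    record Interpretation {X} (𝔛 : Formers X) : Set₁ where
      field
        Sat : ∀ {Γ} → Env Γ → X Γ → Set
        from-sat : ∀ {Γ} r (ρ : Env Γ) x →
          Sat ρ (fromX 𝔛 r x) ⇔ (∃ λ b → base r ⦅ b ⦆ ∈ Trb I × Sat (++⁺ ρ b) x)
        union-sat : ∀ {Γ} (ρ : Env Γ) x y → Sat ρ (unionX 𝔛 x y) ⇔ (Sat ρ x ⊎ Sat ρ y)
        guard-sat : ∀ {Γ} (ρ : Env Γ) φ x → Sat ρ (guardX 𝔛 φ x) ⇔ (T (holds ρ φ) × Sat ρ x)
    open Interpretation

    condInterpretation : Interpretation condFormers
    condInterpretation = record
      { Sat = λ ρ ψ → T (holds ρ ψ)
      ; from-sat = λ r ρ ψ → T-witnessIn ρ r ψ (Trb I)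
      ; union-sat = λ ρ ψ φ → T-∨
      ; guard-sat = λ ρ φ ψ → T-and
      }

    queryInterpretation : GFact → Interpretation queryFormers
    queryInterpretation g = record
      { Sat = λ ρ Q → Emits ρ Q g
      ; from-sat = λ r ρ Q → ⇔-refl
      ; union-sat = λ ρ Q R → ⇔-refl
      ; guard-sat = λ ρ φ Q → ⇔-refl
      }

    Meets : ∀ {X} {𝔛 : Formers X} → Interpretation 𝔛 →
      ∀ {Γ ss} → Env Γ → Cont X Γ ss → (Tuple ss → Set) → Set
    Meets 𝕀 {Γ} {ss} ρ k P = ∀ {Δ} (w : Ren Γ Δ) (ρ' : Env Δ) → ρ ⊑⟨ w ⟩ ρ' →
      (us : Args Δ ss) → Sat 𝕀 ρ' (k w us) ⇔ P (evalArgs ρ' us)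

    mutual
      forEach-sound : ∀ {X} {𝔛 : Formers X} (𝕀 : Interpretation 𝔛) {Γ ss} (R : RA ss) (ρ : Env Γ)
        {k : Cont X Γ ss} {P : Tuple ss → Set} →
        Meets 𝕀 ρ k P → Sat 𝕀 ρ (forEach 𝔛 R k) ⇔ (∃ λ u → Eval I R u × P u)
      forEach-sound 𝕀 {Γ} (base r) ρ {k} {P} meets =
        ⇔-trans (from-sat 𝕀 r ρ _) (∃-cong λ {b} → base-∈-Trb I r b ×-⇔ atFresh b)
        where
          atFresh : ∀ b → Sat 𝕀 (++⁺ ρ b) (k ∈-++⁺ˡ (freshVars Γ)) ⇔ P b
          atFresh b = ⇔-subst P (evalArgs-freshVars ρ b)
                        (meets ∈-++⁺ˡ (++⁺ ρ b) (lookup-++⁺ˡ ρ b) (freshVars Γ))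
      forEach-sound 𝕀 (proj cs R) ρ {P = P} meets = ⇔-trans
        (forEach-sound 𝕀 R ρ {P = P ∘ project cs} λ w ρ' ext us →
           ⇔-subst P (evalArgs-proj ρ' cs us) (meets w ρ' ext (projArgs cs us)))
        (mk⇔ (λ (u , u∈ , p) → project cs u , (u , u∈ , refl) , p)
             (λ { (_ , (u , u∈ , refl) , p) → u , u∈ , p }))
      forEach-sound 𝕀 (sel θ R) ρ {P = P} meets = ⇔-trans
        (forEach-sound 𝕀 R ρ {P = λ u → T (evalB u θ) × P u} λ w ρ' ext us →
           ⇔-trans (guard-sat 𝕀 ρ' _ _)
             (⇔-subst T (evalB-sub ρ' us θ) ⇔-refl ×-⇔ meets w ρ' ext us))
        (mk⇔ (λ (u , u∈ , h , p) → u , (u∈ , Equivalence.to T-≡ h) , p)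
             (λ (u , (u∈ , e) , p) → u , u∈ , Equivalence.from T-≡ e , p))
      forEach-sound 𝕀 (union R S) ρ meets = ⇔-trans (union-sat 𝕀 ρ _ _)
        (⇔-trans (forEach-sound 𝕀 R ρ meets ⊎-⇔ forEach-sound 𝕀 S ρ meets)
          (mk⇔ (λ { (inj₁ (u , u∈ , p)) → u , inj₁ u∈ , p ; (inj₂ (u , u∈ , p)) → u , inj₂ u∈ , p })
               (λ { (u , inj₁ u∈ , p) → inj₁ (u , u∈ , p) ; (u , inj₂ u∈ , p) → inj₂ (u , u∈ , p) })))
      forEach-sound 𝕀 (prod R S) ρ {P = P} meets = ⇔-trans
        (forEach-sound 𝕀 R ρ {P = λ u → ∃ λ v → Eval I S v × P (++⁺ u v)} λ w ρ' ext us →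
           forEach-sound 𝕀 S ρ' λ w' ρ'' ext' vs →
             ⇔-subst P (evalArgs-++⁺-ren ext' us vs)
               (meets (w' ∘ w) ρ'' (λ x → trans (ext' (w x)) (ext x)) (++⁺ (renArgs w' us) vs)))
        (mk⇔ (λ (u , u∈ , v , v∈ , p) → ++⁺ u v , (u , v , u∈ , v∈ , refl) , p)
             (λ { (_ , (u , v , u∈ , v∈ , refl) , p) → u , u∈ , v , v∈ , p }))
        where
          evalArgs-++⁺-ren : ∀ {Δ Θ ss ts} {w' : Ren Δ Θ} {ρ' ρ''} → ρ' ⊑⟨ w' ⟩ ρ'' →
            (us : Args Δ ss) (vs : Args Θ ts) →
            evalArgs ρ'' (++⁺ (renArgs w' us) vs) ≡ ++⁺ (evalArgs ρ' us) (evalArgs ρ'' vs)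
          evalArgs-++⁺-ren {ρ'' = ρ''} ext' us vs =
            trans (evalArgs-++⁺ ρ'' _ vs) (cong (λ t → ++⁺ t (evalArgs ρ'' vs)) (evalArgs-ren ext' us))
      forEach-sound 𝕀 (diff R S) ρ {P = P} meets = ⇔-trans
        (forEach-sound 𝕀 R ρ {P = λ u → ¬ Eval I S u × P u} λ w ρ' ext us →
           ⇔-trans (guard-sat 𝕀 ρ' _ _)
             (⇔-trans T-not (¬-cong-⇔ (memberOf-sound S ρ' us)) ×-⇔ meets w ρ' ext us))
        (mk⇔ (λ (u , u∈ , u∉ , p) → u , (u∈ , u∉) , p)
             (λ (u , (u∈ , u∉) , p) → u , u∈ , u∉ , p))

      memberOf-sound : ∀ {Δ ss} (S : RA ss) (ρ : Env Δ) (us : Args Δ ss) →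
        T (holds ρ (memberOf S us)) ⇔ Eval I S (evalArgs ρ us)
      memberOf-sound S ρ us = ⇔-trans
        (forEach-sound condInterpretation S ρ {P = _≡ evalArgs ρ us} λ w ρ' ext vs →
           ⇔-subst (evalArgs ρ' vs ≡_) (evalArgs-ren ext us) (T-eqArgs ρ' vs (renArgs w us)))
        (mk⇔ (λ { (v , v∈ , refl) → v∈ }) (λ u∈ → _ , u∈ , refl))

  translate-emits : ∀ (I : Instance) {ss} (R : RA ss) (t : Tuple ss) →
    Semantics.Emits (Trb I) [] (translate R) (R ⦅ t ⦆) ⇔ Eval I R t
  translate-emits I R t = ⇔-trans
    (forEach-sound (queryInterpretation (R ⦅ t ⦆)) R [] {P = λ u → R ⦅ t ⦆ ≡ R ⦅ u ⦆} λ _ _ _ _ → ⇔-refl)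
    (mk⇔ (λ (u , u∈ , e) → subst (Eval I R) (sym (⦅⦆-injective R e)) u∈) (λ t∈ → t , t∈ , refl))
    where open Soundness I

  translate-correct : ∀ (I : Instance) {ss} (R : RA ss) (t : Tuple ss) →
    (∃ λ F → ∃ λ F' → (Init ⌊ translate R ⌋q (Trb I) ⟶! Ans F') × F' ↭ (R ⦅ t ⦆ ∷ F)) ⇔ Eval I R t
  translate-correct I R t = mk⇔
    (λ (_ , _ , (run , _) , F'↭) →
       Equivalence.to (translate-emits I R t)
         (Equivalence.to (query-answer (translate R) run _) (∈-resp-↭ (↭-sym F'↭) (here refl))))
    (λ t∈ →
       let F' , run = query-terminates (translate R)
           ys , zs , F'≡ = ∈-∃++ (Equivalence.from (query-answer (translate R) run _)
                                   (Equivalence.from (translate-emits I R t) t∈))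
       in ys ++ zs , F' , (run , λ _ ()) , subst (_↭ R ⦅ t ⦆ ∷ ys ++ zs) (sym F'≡) (shift _ ys zs))
    where open QueryMachine (Trb I)

theorem42 : (D : Domain) (Sch : Schema D) →
    let open Lang D Sch
    in ∀ {ss} (R : RA ss) →
       Σ (Query []) λ Q → Closed Q × Deterministic Q ×
         (∀ (I : Instance) → ValidInstance I → ∀ (t : Tuple ss) →
           (∃ λ F → ∃ λ F' → (Init Q (Trb I) ⟶! Ans F') × F' ↭ (R ⦅ t ⦆ ∷ F))
           ⇔ Eval I R t)
theorem42 D Sch R =
  ⌊ translate R ⌋q , closedQ (translate R) , deterministicQ (translate R) , λ I _ → translate-correct I R
  where open Translation D Sch
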